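{- Consider $n$ agents with utility caps $c_1\ge c_2\ge\dots\ge c_n>0$ and $M$ indivisible single-copy goods with uniform utilities $u_1\ge u_2\ge\dots\ge u_M\ge0$ (good $j$ has utility $u_j$ for every agent). For an integral allocation $x$ (agent $i$ receives the set $x_i$) let $\mathrm{NSW}(x)=\left(\prod_i\min(c_i,\sum_{j\in x_i}u_j)\right)^{1/n}$, and let $x^{**}$ maximize $\mathrm{NSW}$. Let $h,k\ge0$ be integers with $h<n-k$, let \[\delta=\frac{\sum_{h+1\le j\le M}u_j-\sum_{n-k+1\le i\le n}c_i}{n-h-k},\] and suppose $c_{n-k+1}\le\delta<c_{n-k}$ and $\delta<u_h$. Then \[\mathrm{NSW}(x^{**})\le\left(\prod_{1\le i\le h}\min(c_i,u_i)\cdot\delta^{\,n-h-k}\cdot\prod_{n-k+1\le i\le n}c_i\right)^{1/n}.\]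
   Context: Conditions involving the nonexistent index $c_{n+1}$ (when $k=0$) or $u_0$ (when $h=0$) are to be read as vacuous.
   Formalization: The utility caps $c_i$ and the uniform utilities $u_j$ take values in ℚ. -}

module Defs where

open import Data.Nat as ℕ using (ℕ; zero; suc; _∸_)
open import Data.Fin as Fin using (Fin)
open import Relation.Nullary using (yes; no)
open import Data.Maybe using (Maybe; just; nothing)
open import Data.Bool using (Bool; true; false; if_then_else_)
open import Data.Integer using (+_)
open import Data.Rational using (ℚ; 0ℚ; 1ℚ; _+_; _*_; _/_; _⊓_)

sumTo : ℕ → (ℕ → ℚ) → ℚ
sumTo zero    f = 0ℚ
sumTo (suc b) f = sumTo b f + f b

-- Σ_{a ≤ i < b} f i  (0-based indices)
sumFromTo : ℕ → ℕ → (ℕ → ℚ) → ℚ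
sumFromTo a b f = sumTo (b ∸ a) (λ i → f (a ℕ.+ i))

prodTo : ℕ → (ℕ → ℚ) → ℚ
prodTo zero    f = 1ℚ
prodTo (suc b) f = prodTo b f * f b

pow : ℚ → ℕ → ℚ
pow q zero    = 1ℚ
pow q (suc e) = pow q e * q

-- 1 / d  (only used with d > 0; value 0 at d = 0 is irrelevant)
inv : ℕ → ℚ
inv zero    = 0ℚ
inv (suc d) = + 1 / suc d

-- a vector on Fin m read as a function on ℕ (0-based), 0 outside range
at : ∀ {m} → (Fin m → ℚ) → ℕ → ℚ
at {zero}  f _       = 0ℚ
at {suc m} f zero    = f Fin.zero
at {suc m} f (suc i) = at (λ j → f (Fin.suc j)) i

sumFin : ∀ {m} → (Fin m → ℚ) → ℚ
sumFin {zero}  f = 0ℚ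
sumFin {suc m} f = f Fin.zero + sumFin (λ j → f (Fin.suc j))

prodFin : ∀ {m} → (Fin m → ℚ) → ℚ
prodFin {zero}  f = 1ℚ
prodFin {suc m} f = f Fin.zero * prodFin (λ j → f (Fin.suc j))

-- An integral allocation of M single-copy goods to n agents:
-- good j goes to agent i (just i) or to nobody (nothing).
Allocation : ℕ → ℕ → Set
Allocation n M = Fin M → Maybe (Fin n)

owns : ∀ {n} → Maybe (Fin n) → Fin n → Bool
owns nothing  i = false
owns (just a) i with a Fin.≟ i
... | yes _ = true
... | no  _ = false

bundleValue : ∀ {n M} → (Fin M → ℚ) → Allocation n M → Fin n → ℚ
bundleValue u x i = sumFin (λ j → if owns (x j) i then u j else 0ℚ)

-- NSW(x)^n = Π_i min(c_i, Σ_{j ∈ x_i} u_j)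
nswPow : ∀ {n M} → (Fin n → ℚ) → (Fin M → ℚ) → Allocation n M → ℚ
nswPow c u x = prodFin (λ i → c i ⊓ bundleValue u x i)

-- Π_{a ≤ i < b} f i  (0-based indices)
prodFromTo : ℕ → ℕ → (ℕ → ℚ) → ℚ
prodFromTo a b f = prodTo (b ∸ a) (λ i → f (a ℕ.+ i))

module Submission where

-- The first N = n − k agents ("head") have caps above δ, the last k ("tail") at most δ, and
-- the h best goods ("top") have utilities above δ.  The bound holds for every allocation x.  Let Wᵢ = min(C i, value of xᵢ).  A head agent is
-- compared with the benchmark sᵢ = C i ⊓ U g for its best top good g (δ if it has none), a
-- tail agent with sᵢ = C i.  Then Wᵢ·δ ≤ sᵢ·aᵢ (agentBound), where the allowance aᵢ counts
-- its non-top goods, δ per top good and the slack δ − C i of a tail agent; by the choice of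
-- δ the allowances sum to at most n·δ (allowance-total), so AM–GM gives Π Wᵢ ≤ Π sᵢ.  An
-- exchange argument (matchingBound) bounds the head benchmarks by Π_{j<h} (C j ⊓ U j)·δ^(N−h).
-- If δ = 0, pigeonhole yields an agent without top goods whose utility is 0.
-- The file develops ℚ and finite-product facts, AM–GM, the matching bound, allocation
-- bookkeeping and the per-agent inequalities, proves the bound for ℕ-indexed data (module
-- Core) and finally transfers it to the Fin-indexed statement.

open import Defs
open import Data.Nat as ℕ using (ℕ; _∸_)
open import Data.Fin as Fin using (Fin)
open import Data.Rational using (ℚ; 0ℚ; _≤_; _<_; _-_; _*_; _⊓_)

open import Data.Nat using (zero; suc; z≤n; s≤s)
import Data.Nat.Properties as ℕP
import Data.Fin.Properties as FinP
import Data.Integer as ℤ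
open import Data.Rational
open import Data.Rational.Properties
import Data.Rational.Unnormalised as ℚᵘ
import Data.Rational.Unnormalised.Properties as ℚᵘP
import Data.Integer.Solver
import Data.Rational.Solver
open import Data.Bool using (Bool; true; false; if_then_else_; T)
open import Data.Sum using (inj₁; inj₂)
open import Data.Maybe using (Maybe; just; nothing; _<∣>_)
import Data.Maybe as Maybe
import Data.Maybe.Properties as MaybeP
open import Data.Product using (∃; _×_; _,_; proj₁; proj₂)
open import Function using (_∘_)
open import Data.Empty using (⊥-elim)
open import Relation.Nullary using (¬_; does; yes; no)
open import Relation.Nullary.Decidable using (dec-true; dec-false)
open import Relation.Binary.PropositionalEquality
open import Relation.Binary.Definitions using (tri<; tri≈; tri>)

ones : ℕ → ℚ
ones n = sumTo n (λ _ → 1ℚ)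

ones-inv : ∀ d → ones (suc d) * inv (suc d) ≡ 1ℚ
ones-inv d = toℚᵘ-injective (ℚᵘP.≃-trans (toℚᵘ-homo-* (ones (suc d)) (inv (suc d)))
  (ℚᵘP.≃-trans (ℚᵘP.*-cong (ones-asFraction (suc d)) (toℚᵘ-fromℚᵘ (ℚᵘ.mkℚᵘ (ℤ.+ 1) d)))
    (ℚᵘ.*≡* (solve 1 (λ x → (x :* con (ℤ.+ 1)) :* con (ℤ.+ 1) := con (ℤ.+ 1) :* (con (ℤ.+ 1) :* x)) refl (ℤ.+ suc d)))))
  where
  open Data.Integer.Solver.+-*-Solver
  ones-asFraction : ∀ n → toℚᵘ (ones n) ℚᵘ.≃ ℚᵘ.mkℚᵘ (ℤ.+ n) 0
  ones-asFraction zero    = ℚᵘ.*≡* refl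
  ones-asFraction (suc n) = ℚᵘP.≃-trans (toℚᵘ-homo-+ (ones n) 1ℚ)
    (ℚᵘP.≃-trans (ℚᵘP.+-congˡ (toℚᵘ 1ℚ) (ones-asFraction n))
      (ℚᵘ.*≡* (solve 1 (λ x → (x :* con (ℤ.+ 1) :+ con (ℤ.+ 1) :* con (ℤ.+ 1)) :* con (ℤ.+ 1)
                                := (con (ℤ.+ 1) :+ x) :* (con (ℤ.+ 1) :* con (ℤ.+ 1))) refl (ℤ.+ n))))

open Data.Rational.Solver.+-*-Solver using (solve; _:+_; _:*_; _:-_; :-_; _:=_; con)

0≤1 : 0ℚ ≤ 1ℚ
0≤1 = nonNegative⁻¹ 1ℚ

0<1 : 0ℚ < 1ℚ
0<1 = positive⁻¹ 1ℚ

*-nonNeg : ∀ {p q} → 0ℚ ≤ p → 0ℚ ≤ q → 0ℚ ≤ p * q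
*-nonNeg {p} {q} p≥0 q≥0 =
  nonNegative⁻¹ (p * q) {{nonNeg*nonNeg⇒nonNeg p {{nonNegative p≥0}} q {{nonNegative q≥0}}}}

*-pos : ∀ {p q} → 0ℚ < p → 0ℚ < q → 0ℚ < p * q
*-pos {p} {q} p>0 q>0 = positive⁻¹ (p * q) {{pos*pos⇒pos p {{positive p>0}} q {{positive q>0}}}}

*-monoˡ-≤-≥0 : ∀ {p q} r → 0ℚ ≤ r → p ≤ q → r * p ≤ r * q
*-monoˡ-≤-≥0 r r≥0 = *-monoˡ-≤-nonNeg r {{nonNegative r≥0}}

*-monoʳ-≤-≥0 : ∀ {p q} r → 0ℚ ≤ r → p ≤ q → p * r ≤ q * r
*-monoʳ-≤-≥0 r r≥0 = *-monoʳ-≤-nonNeg r {{nonNegative r≥0}}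

*-mono-≤-≥0 : ∀ {p q r s} → 0ℚ ≤ p → 0ℚ ≤ r → p ≤ q → r ≤ s → p * r ≤ q * s
*-mono-≤-≥0 {p} {q} {r} {s} p≥0 r≥0 p≤q r≤s =
  ≤-trans (*-monoˡ-≤-≥0 p p≥0 r≤s) (*-monoʳ-≤-≥0 s (≤-trans r≥0 r≤s) p≤q)

*-cancelʳ-≤-pos′ : ∀ {p q} r → 0ℚ < r → p * r ≤ q * r → p ≤ q
*-cancelʳ-≤-pos′ r r>0 = *-cancelʳ-≤-pos r {{positive r>0}}

0≤q-p⇒p≤q : ∀ {p q} → 0ℚ ≤ q - p → p ≤ q
0≤q-p⇒p≤q {p} {q} d = begin
    p             ≡⟨ sym (+-identityʳ p) ⟩
    p + 0ℚ        ≤⟨ +-monoʳ-≤ p d ⟩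
    p + (q - p)   ≡⟨ solve 2 (λ p q → p :+ (q :- p) := q) refl p q ⟩
    q             ∎
  where open ≤-Reasoning

square-nonNeg : ∀ p → 0ℚ ≤ p * p
square-nonNeg p with ≤-total 0ℚ p
... | inj₁ p≥0 = *-nonNeg p≥0 p≥0
... | inj₂ p≤0 = subst (0ℚ ≤_) (solve 1 (λ p → (:- p) :* (:- p) := p :* p) refl p) (*-nonNeg -p≥0 -p≥0)
  where
  -p≥0 : 0ℚ ≤ - p
  -p≥0 = neg-antimono-≤ p≤0

restrict : ∀ {b} {P : ℕ → Set} → (∀ i → i ℕ.< suc b → P i) → ∀ i → i ℕ.< b → P i
restrict p i i<b = p i (ℕP.m<n⇒m<1+n i<b)

sumTo-cong : ∀ b {f g : ℕ → ℚ} → (∀ i → i ℕ.< b → f i ≡ g i) → sumTo b f ≡ sumTo b g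
sumTo-cong zero    _  = refl
sumTo-cong (suc b) eq = cong₂ _+_ (sumTo-cong b (restrict eq)) (eq b ℕP.≤-refl)

prodTo-cong : ∀ b {f g : ℕ → ℚ} → (∀ i → i ℕ.< b → f i ≡ g i) → prodTo b f ≡ prodTo b g
prodTo-cong zero    _  = refl
prodTo-cong (suc b) eq = cong₂ _*_ (prodTo-cong b (restrict eq)) (eq b ℕP.≤-refl)

sumTo-mono : ∀ b {f g : ℕ → ℚ} → (∀ i → i ℕ.< b → f i ≤ g i) → sumTo b f ≤ sumTo b g
sumTo-mono zero    _  = ≤-refl
sumTo-mono (suc b) le = +-mono-≤ (sumTo-mono b (restrict le)) (le b ℕP.≤-refl)

sumTo-nonNeg : ∀ b {f : ℕ → ℚ} → (∀ i → i ℕ.< b → 0ℚ ≤ f i) → 0ℚ ≤ sumTo b f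
sumTo-nonNeg zero    _   = ≤-refl
sumTo-nonNeg (suc b) f≥0 = +-mono-≤ (sumTo-nonNeg b (restrict f≥0)) (f≥0 b ℕP.≤-refl)

prodTo-nonNeg : ∀ b {f : ℕ → ℚ} → (∀ i → i ℕ.< b → 0ℚ ≤ f i) → 0ℚ ≤ prodTo b f
prodTo-nonNeg zero    _   = 0≤1
prodTo-nonNeg (suc b) f≥0 = *-nonNeg (prodTo-nonNeg b (restrict f≥0)) (f≥0 b ℕP.≤-refl)

prodTo-mono : ∀ b {f g : ℕ → ℚ} → (∀ i → i ℕ.< b → 0ℚ ≤ f i) → (∀ i → i ℕ.< b → f i ≤ g i) →
              prodTo b f ≤ prodTo b g
prodTo-mono zero    _   _  = ≤-refl
prodTo-mono (suc b) f≥0 le =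
  *-mono-≤-≥0 (prodTo-nonNeg b (restrict f≥0)) (f≥0 b ℕP.≤-refl)
              (prodTo-mono b (restrict f≥0) (restrict le)) (le b ℕP.≤-refl)

sumTo-zero : ∀ b → sumTo b (λ _ → 0ℚ) ≡ 0ℚ
sumTo-zero zero    = refl
sumTo-zero (suc b) = trans (+-identityʳ _) (sumTo-zero b)

sumTo-+ : ∀ b (f g : ℕ → ℚ) → sumTo b (λ i → f i + g i) ≡ sumTo b f + sumTo b g
sumTo-+ zero    f g = refl
sumTo-+ (suc b) f g = trans (cong (_+ (f b + g b)) (sumTo-+ b f g))
  (solve 4 (λ x y z w → (x :+ y) :+ (z :+ w) := (x :+ z) :+ (y :+ w)) refl
         (sumTo b f) (sumTo b g) (f b) (g b))

sumTo-neg : ∀ b (f : ℕ → ℚ) → sumTo b (λ i → - f i) ≡ - sumTo b f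
sumTo-neg zero    f = refl
sumTo-neg (suc b) f = trans (cong (_+ (- f b)) (sumTo-neg b f)) (sym (neg-distrib-+ (sumTo b f) (f b)))

sumTo-scale : ∀ b c (f : ℕ → ℚ) → sumTo b (λ i → c * f i) ≡ c * sumTo b f
sumTo-scale zero    c f = sym (*-zeroʳ c)
sumTo-scale (suc b) c f =
  trans (cong (_+ (c * f b)) (sumTo-scale b c f)) (sym (*-distribˡ-+ c (sumTo b f) (f b)))

prodTo-* : ∀ b (f g : ℕ → ℚ) → prodTo b (λ i → f i * g i) ≡ prodTo b f * prodTo b g
prodTo-* zero    f g = refl
prodTo-* (suc b) f g = trans (cong (_* (f b * g b)) (prodTo-* b f g))
  (solve 4 (λ x y z w → (x :* y) :* (z :* w) := (x :* z) :* (y :* w)) refl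
         (prodTo b f) (prodTo b g) (f b) (g b))

sumTo-swap : ∀ a b (f : ℕ → ℕ → ℚ) →
             sumTo a (λ i → sumTo b (f i)) ≡ sumTo b (λ j → sumTo a (λ i → f i j))
sumTo-swap zero    b f = sym (sumTo-zero b)
sumTo-swap (suc a) b f = trans (cong (_+ sumTo b (f a)) (sumTo-swap a b f))
  (sym (sumTo-+ b (λ j → sumTo a (λ i → f i j)) (f a)))

sumTo-split : ∀ a b (f : ℕ → ℚ) → sumTo (a ℕ.+ b) f ≡ sumTo a f + sumTo b (λ i → f (a ℕ.+ i))
sumTo-split a zero    f rewrite ℕP.+-identityʳ a = sym (+-identityʳ _)
sumTo-split a (suc b) f rewrite ℕP.+-suc a b =
  trans (cong (_+ f (a ℕ.+ b)) (sumTo-split a b f))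
        (+-assoc (sumTo a f) (sumTo b (λ i → f (a ℕ.+ i))) (f (a ℕ.+ b)))

prodTo-split : ∀ a b (f : ℕ → ℚ) → prodTo (a ℕ.+ b) f ≡ prodTo a f * prodTo b (λ i → f (a ℕ.+ i))
prodTo-split a zero    f rewrite ℕP.+-identityʳ a = sym (*-identityʳ _)
prodTo-split a (suc b) f rewrite ℕP.+-suc a b =
  trans (cong (_* f (a ℕ.+ b)) (prodTo-split a b f))
        (*-assoc (prodTo a f) (prodTo b (λ i → f (a ℕ.+ i))) (f (a ℕ.+ b)))

sumTo-first : ∀ b (f : ℕ → ℚ) → sumTo (suc b) f ≡ f 0 + sumTo b (λ i → f (suc i))
sumTo-first b f = trans (sumTo-split 1 b f) (cong (_+ sumTo b (λ i → f (suc i))) (+-identityˡ (f 0)))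

prodTo-first : ∀ b (f : ℕ → ℚ) → prodTo (suc b) f ≡ f 0 * prodTo b (λ i → f (suc i))
prodTo-first b f = trans (prodTo-split 1 b f) (cong (_* prodTo b (λ i → f (suc i))) (*-identityˡ (f 0)))

sumTo-term : ∀ b {f : ℕ → ℚ} → (∀ i → i ℕ.< b → 0ℚ ≤ f i) → ∀ p → p ℕ.< b → f p ≤ sumTo b f
sumTo-term (suc b) {f} f≥0 p p<1+b with p ℕ.≟ b
... | yes refl = begin
  f p               ≡⟨ sym (+-identityˡ (f p)) ⟩
  0ℚ + f p          ≤⟨ +-monoˡ-≤ (f p) (sumTo-nonNeg b (restrict f≥0)) ⟩
  sumTo b f + f p   ∎
  where open ≤-Reasoning
... | no p≢b = begin
  f p               ≤⟨ sumTo-term b (restrict f≥0) p (ℕP.≤∧≢⇒< (ℕP.≤-pred p<1+b) p≢b) ⟩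
  sumTo b f         ≡⟨ sym (+-identityʳ _) ⟩
  sumTo b f + 0ℚ    ≤⟨ +-monoʳ-≤ (sumTo b f) (f≥0 b ℕP.≤-refl) ⟩
  sumTo b f + f b   ∎
  where open ≤-Reasoning

prodTo-zero : ∀ b {f : ℕ → ℚ} p → p ℕ.< b → f p ≡ 0ℚ → prodTo b f ≡ 0ℚ
prodTo-zero (suc b) {f} p p<1+b fp≡0 with p ℕ.≟ b
... | yes refl = trans (cong (prodTo p f *_) fp≡0) (*-zeroʳ (prodTo p f))
... | no p≢b   = trans (cong (_* f b) (prodTo-zero b p (ℕP.≤∧≢⇒< (ℕP.≤-pred p<1+b) p≢b) fp≡0))
                       (*-zeroˡ (f b))

dropAt : (ℕ → ℚ) → ℕ → ℕ → ℚ
dropAt f p i = if does (i ℕ.≟ p) then 1ℚ else f i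

dropAt-≢ : ∀ f {p i} → i ≢ p → dropAt f p i ≡ f i
dropAt-≢ f {p} {i} i≢p = cong (λ t → if t then 1ℚ else f i) (dec-false (i ℕ.≟ p) i≢p)

dropAt-≡ : ∀ f p → dropAt f p p ≡ 1ℚ
dropAt-≡ f p = cong (λ t → if t then 1ℚ else f p) (dec-true (p ℕ.≟ p) refl)

prodTo-extract : ∀ b (f : ℕ → ℚ) p → p ℕ.< b → prodTo b f ≡ f p * prodTo b (dropAt f p)
prodTo-extract (suc b) f p p<1+b with b ℕ.≟ p
... | yes refl = begin
  prodTo b f * f b                     ≡⟨ cong (_* f b) (prodTo-cong b (λ i i<b → sym (kept i i<b))) ⟩
  prodTo b (dropAt f b) * f b          ≡⟨ *-comm _ (f b) ⟩
  f b * prodTo b (dropAt f b)          ≡⟨ cong (f b *_) (sym (*-identityʳ _)) ⟩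
  f b * (prodTo b (dropAt f b) * 1ℚ)   ≡⟨ cong (λ t → f b * (prodTo b (dropAt f b) * t)) dropped ⟩
  f b * (prodTo b (dropAt f b) * dropAt f b b)   ∎
  where
  open ≡-Reasoning
  kept : ∀ i → i ℕ.< b → dropAt f b i ≡ f i
  kept i i<b = dropAt-≢ f (ℕP.<⇒≢ i<b)
  dropped : 1ℚ ≡ dropAt f b b
  dropped = sym (dropAt-≡ f b)
... | no b≢p = begin
  prodTo b f * f b                                 ≡⟨ cong (_* f b) (prodTo-extract b f p p<b) ⟩
  f p * prodTo b (dropAt f p) * f b                ≡⟨ *-assoc (f p) _ (f b) ⟩
  f p * (prodTo b (dropAt f p) * f b)              ≡⟨ cong (λ t → f p * (prodTo b (dropAt f p) * t)) kept ⟩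
  f p * (prodTo b (dropAt f p) * dropAt f p b)     ∎
  where
  open ≡-Reasoning
  kept : f b ≡ dropAt f p b
  kept = sym (dropAt-≢ f b≢p)
  p<b : p ℕ.< b
  p<b = ℕP.≤∧≢⇒< (ℕP.≤-pred p<1+b) (λ p≡b → b≢p (sym p≡b))

piecewise : ℕ → (ℕ → ℚ) → (ℕ → ℚ) → ℕ → ℚ
piecewise N f g i = if does (i ℕ.<? N) then f i else g i

piecewise-< : ∀ N (f g : ℕ → ℚ) {i} → i ℕ.< N → piecewise N f g i ≡ f i
piecewise-< N f g {i} i<N = cong (λ t → if t then f i else g i) (dec-true (i ℕ.<? N) i<N)

piecewise-≥ : ∀ N (f g : ℕ → ℚ) {i} → N ℕ.≤ i → piecewise N f g i ≡ g i
piecewise-≥ N f g {i} N≤i = cong (λ t → if t then f i else g i) (dec-false (i ℕ.<? N) (ℕP.≤⇒≯ N≤i))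

sumTo-piecewise : ∀ N K (f g : ℕ → ℚ) →
                  sumTo (N ℕ.+ K) (piecewise N f g) ≡ sumTo N f + sumTo K (λ i → g (N ℕ.+ i))
sumTo-piecewise N K f g = trans (sumTo-split N K (piecewise N f g))
  (cong₂ _+_ (sumTo-cong N (λ i → piecewise-< N f g))
             (sumTo-cong K (λ i _ → piecewise-≥ N f g (ℕP.m≤m+n N i))))

prodTo-piecewise : ∀ N K (f g : ℕ → ℚ) →
                   prodTo (N ℕ.+ K) (piecewise N f g) ≡ prodTo N f * prodTo K (λ i → g (N ℕ.+ i))
prodTo-piecewise N K f g = trans (prodTo-split N K (piecewise N f g))
  (cong₂ _*_ (prodTo-cong N (λ i → piecewise-< N f g))
             (prodTo-cong K (λ i _ → piecewise-≥ N f g (ℕP.m≤m+n N i))))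

prodTo-const : ∀ b q → prodTo b (λ _ → q) ≡ pow q b
prodTo-const zero    q = refl
prodTo-const (suc b) q = cong (_* q) (prodTo-const b q)

pow-+ : ∀ q a b → pow q (a ℕ.+ b) ≡ pow q a * pow q b
pow-+ q a b = begin
  pow q (a ℕ.+ b)                                 ≡⟨ sym (prodTo-const (a ℕ.+ b) q) ⟩
  prodTo (a ℕ.+ b) (λ _ → q)                      ≡⟨ prodTo-split a b (λ _ → q) ⟩
  prodTo a (λ _ → q) * prodTo b (λ _ → q)         ≡⟨ cong₂ _*_ (prodTo-const a q) (prodTo-const b q) ⟩
  pow q a * pow q b                               ∎
  where open ≡-Reasoning

pow-nonNeg : ∀ q b → 0ℚ ≤ q → 0ℚ ≤ pow q b
pow-nonNeg q zero    q≥0 = 0≤1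
pow-nonNeg q (suc b) q≥0 = *-nonNeg (pow-nonNeg q b q≥0) q≥0

pow-pos : ∀ q b → 0ℚ < q → 0ℚ < pow q b
pow-pos q zero    q>0 = 0<1
pow-pos q (suc b) q>0 = *-pos (pow-pos q b q>0) q>0

pow-mono : ∀ b {p q} → 0ℚ ≤ p → p ≤ q → pow p b ≤ pow q b
pow-mono zero    p≥0 p≤q = ≤-refl
pow-mono (suc b) p≥0 p≤q = *-mono-≤-≥0 (pow-nonNeg _ b p≥0) p≥0 (pow-mono b p≥0 p≤q) p≤q

ones-nonNeg : ∀ n → 0ℚ ≤ ones n
ones-nonNeg n = sumTo-nonNeg n (λ _ _ → 0≤1)

ones-+ : ∀ a b → ones (a ℕ.+ b) ≡ ones a + ones b
ones-+ a b = sumTo-split a b (λ _ → 1ℚ)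

sumTo-const : ∀ n q → sumTo n (λ _ → q) ≡ ones n * q
sumTo-const zero    q = sym (*-zeroˡ q)
sumTo-const (suc n) q = trans (cong (_+ q) (sumTo-const n q))
  (solve 2 (λ a q → a :* q :+ q := (a :+ con 1ℚ) :* q) refl (ones n) q)

inv-nonNeg : ∀ d → 0ℚ ≤ inv d
inv-nonNeg zero    = ≤-refl
inv-nonNeg (suc d) = nonNegative⁻¹ _ {{normalize-nonNeg 1 (suc d)}}

-- The arithmetic–geometric mean inequality.

-- The average of the first n values (taken to be 0 when n = 0).
mean : ℕ → (ℕ → ℚ) → ℚ
mean n z = sumTo n z * inv n

ones-cancel : ∀ d x → ones (suc d) * (x * inv (suc d)) ≡ x
ones-cancel d x = begin
  ones (suc d) * (x * inv (suc d))
    ≡⟨ solve 3 (λ o x i → o :* (x :* i) := x :* (o :* i)) refl (ones (suc d)) x (inv (suc d)) ⟩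
  x * (ones (suc d) * inv (suc d))
    ≡⟨ cong (x *_) (ones-inv d) ⟩
  x * 1ℚ
    ≡⟨ *-identityʳ x ⟩
  x
    ∎
  where open ≡-Reasoning

ones-mean : ∀ n z → ones n * mean n z ≡ sumTo n z
ones-mean zero    z = *-zeroˡ (mean zero z)
ones-mean (suc d) z = ones-cancel d (sumTo (suc d) z)

mean-nonNeg : ∀ n z → (∀ i → i ℕ.< n → 0ℚ ≤ z i) → 0ℚ ≤ mean n z
mean-nonNeg n z z≥0 = *-nonNeg (sumTo-nonNeg n z≥0) (inv-nonNeg n)

-- The inductive step of AM–GM: for A, B ≥ 0,  Aⁿ·((n+1)B − nA) ≤ Bⁿ⁺¹.
-- It holds because the difference satisfies
--   gap (n+1) = B · gap n + (n+1)·Aⁿ·(A − B)²  with  gap 0 = 0.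
meanStep : ∀ n A B → 0ℚ ≤ A → 0ℚ ≤ B →
           pow A n * ((ones n + 1ℚ) * B - ones n * A) ≤ pow B (suc n)
meanStep n A B A≥0 B≥0 = 0≤q-p⇒p≤q (subst (0ℚ ≤_) (rearrange n) (gap n))
  where
  gapOf : ℕ → ℚ
  gapOf n = pow B (suc n) + ones n * pow A n * A - (ones n + 1ℚ) * pow A n * B

  gap : ∀ n → 0ℚ ≤ gapOf n
  gap zero    = ≤-reflexive (sym (solve 2 (λ A B → con 1ℚ :* B :+ con 0ℚ :* con 1ℚ :* A
                                              :- (con 0ℚ :+ con 1ℚ) :* con 1ℚ :* B := con 0ℚ) refl A B))
  gap (suc n) = subst (0ℚ ≤_) (sym recurrence)
    (+-mono-≤ (*-nonNeg B≥0 (gap n))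
              (*-nonNeg (*-nonNeg (ones-nonNeg (suc n)) (pow-nonNeg A n A≥0)) (square-nonNeg (A - B))))
    where
    recurrence : gapOf (suc n) ≡ B * gapOf n + (ones n + 1ℚ) * pow A n * ((A - B) * (A - B))
    recurrence = solve 5 (λ N P A B R →
        R :* B :+ (N :+ con 1ℚ) :* (P :* A) :* A :- (N :+ con 1ℚ :+ con 1ℚ) :* (P :* A) :* B
      := B :* (R :+ N :* P :* A :- (N :+ con 1ℚ) :* P :* B) :+ (N :+ con 1ℚ) :* P :* ((A :- B) :* (A :- B)))
      refl (ones n) (pow A n) A B (pow B (suc n))

  rearrange : ∀ n → gapOf n ≡ pow B (suc n) - pow A n * ((ones n + 1ℚ) * B - ones n * A)
  rearrange n = solve 5 (λ N P A B R → R :+ N :* P :* A :- (N :+ con 1ℚ) :* P :* B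
                                     := R :- P :* ((N :+ con 1ℚ) :* B :- N :* A))
                        refl (ones n) (pow A n) A B (pow B (suc n))

amgm : ∀ n z → (∀ i → i ℕ.< n → 0ℚ ≤ z i) → prodTo n z ≤ pow (mean n z) n
amgm zero    z z≥0 = ≤-refl
amgm (suc n) z z≥0 = begin
  prodTo n z * z n
    ≤⟨ *-monoʳ-≤-≥0 (z n) (z≥0 n ℕP.≤-refl) (amgm n z (restrict z≥0)) ⟩
  pow A n * z n
    ≡⟨ cong (pow A n *_) last ⟩
  pow A n * ((ones n + 1ℚ) * B - ones n * A)
    ≤⟨ meanStep n A B (mean-nonNeg n z (restrict z≥0)) (mean-nonNeg (suc n) z z≥0) ⟩
  pow B (suc n)
    ∎
  where
  open ≤-Reasoning
  A = mean n z
  B = mean (suc n) z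
  last : z n ≡ (ones n + 1ℚ) * B - ones n * A
  last = trans (solve 2 (λ S x → x := (S :+ x) :- S) refl (sumTo n z) (z n))
               (cong₂ _-_ (sym (ones-mean (suc n) z)) (sym (ones-mean n z)))

amgm-bound : ∀ n z D → (∀ i → i ℕ.< n → 0ℚ ≤ z i) → 0ℚ ≤ D → sumTo n z ≤ ones n * D → prodTo n z ≤ pow D n
amgm-bound zero    z D _   _   _ = ≤-refl
amgm-bound (suc d) z D z≥0 D≥0 sum≤ = ≤-trans (amgm (suc d) z z≥0) (pow-mono (suc d) (mean-nonNeg (suc d) z z≥0) mean≤D)
  where
  open ≤-Reasoning
  mean≤D : mean (suc d) z ≤ D
  mean≤D = begin
    sumTo (suc d) z * inv (suc d)          ≤⟨ *-monoʳ-≤-≥0 (inv (suc d)) (inv-nonNeg (suc d)) sum≤ ⟩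
    ones (suc d) * D * inv (suc d)         ≡⟨ *-assoc (ones (suc d)) D (inv (suc d)) ⟩
    ones (suc d) * (D * inv (suc d))       ≡⟨ ones-cancel d D ⟩
    D                                      ∎

least : (ℕ → Bool) → ℕ → Maybe ℕ
least p zero    = nothing
least p (suc b) = least p b <∣> (if p b then just b else nothing)

least-nothing : ∀ p b → least p b ≡ nothing → ∀ j → j ℕ.< b → p j ≡ false
least-nothing p (suc b) eq j j<1+b with least p b in e | p b in pb
least-nothing p (suc b) () j j<1+b | just _  | _
least-nothing p (suc b) () j j<1+b | nothing | true
... | nothing | false with j ℕ.≟ b
... | yes refl = pb
... | no j≢b   = least-nothing p b e j (ℕP.≤∧≢⇒< (ℕP.≤-pred j<1+b) j≢b)

least-just : ∀ p b {g} → least p b ≡ just g → g ℕ.< b × p g ≡ true × (∀ j → j ℕ.< g → p j ≡ false)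
least-just p (suc b) eq with least p b in e | p b in pb
least-just p (suc b) refl | just g  | _     = let g<b , pg , before = least-just p b e
                                              in ℕP.m<n⇒m<1+n g<b , pg , before
least-just p (suc b) refl | nothing | true  = ℕP.≤-refl , pb , least-nothing p b e
least-just p (suc b) ()   | nothing | false

-- Matchings of agents to goods and the rearrangement bound.
--
-- A partial matching g
-- gives agent i the good g i (or nothing); a matched agent is worth C i ⊓ U j, an unmatched
-- one a fixed default d.  Pairing the j-th best agent with the j-th best good is optimal.

Antitone : (ℕ → ℚ) → Set
Antitone f = ∀ i j → i ℕ.≤ j → f j ≤ f i

NonNeg : (ℕ → ℚ) → Set
NonNeg f = ∀ i → 0ℚ ≤ f i

record Matching (g : ℕ → Maybe ℕ) (N h : ℕ) : Set where
  field
    inRange   : ∀ {i j} → i ℕ.< N → g i ≡ just j → j ℕ.< h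
    injective : ∀ {i i′ j} → i ℕ.< N → i′ ℕ.< N → g i ≡ just j → g i′ ≡ just j → i ≡ i′
open Matching

matchValue : (ℕ → ℚ) → ℚ → ℚ → Maybe ℕ → ℚ
matchValue U d c nothing  = d
matchValue U d c (just j) = c ⊓ U j

profile : (C U : ℕ → ℚ) → ℚ → (ℕ → Maybe ℕ) → ℕ → ℚ
profile C U d g i = matchValue U d (C i) (g i)

pairBound : (C U : ℕ → ℚ) → ℚ → ℕ → ℚ
pairBound C U d j = d ⊔ (C j ⊓ U j)

profile-just : ∀ C U d g {i j} → g i ≡ just j → profile C U d g i ≡ C i ⊓ U j
profile-just C U d g eq = cong (matchValue U d (C _)) eq

profile-nonNeg : ∀ {C U d} g → NonNeg C → NonNeg U → 0ℚ ≤ d → NonNeg (profile C U d g)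
profile-nonNeg g C≥0 U≥0 d≥0 i with g i
... | nothing = d≥0
... | just j  = ⊓-glb (C≥0 i) (U≥0 j)

minProduct-exchange : ∀ {a b x y} → 0ℚ ≤ b → b ≤ a → 0ℚ ≤ y → y ≤ x →
                      (a ⊓ y) * (b ⊓ x) ≤ (a ⊓ x) * (b ⊓ y)
minProduct-exchange {a} {b} {x} {y} b≥0 b≤a y≥0 y≤x with ≤-total b y
... | inj₁ b≤y = begin
  (a ⊓ y) * (b ⊓ x)   ≡⟨ cong ((a ⊓ y) *_) (p≤q⇒p⊓q≡p (≤-trans b≤y y≤x)) ⟩
  (a ⊓ y) * b         ≤⟨ *-monoʳ-≤-≥0 b b≥0 (⊓-monoʳ-≤ a y≤x) ⟩
  (a ⊓ x) * b         ≡⟨ cong ((a ⊓ x) *_) (sym (p≤q⇒p⊓q≡p b≤y)) ⟩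
  (a ⊓ x) * (b ⊓ y)   ∎
  where open ≤-Reasoning
... | inj₂ y≤b = begin
  (a ⊓ y) * (b ⊓ x)   ≡⟨ cong (_* (b ⊓ x)) (p≥q⇒p⊓q≡q (≤-trans y≤b b≤a)) ⟩
  y * (b ⊓ x)         ≤⟨ *-monoˡ-≤-≥0 y y≥0 (⊓-monoˡ-≤ x b≤a) ⟩
  y * (a ⊓ x)         ≡⟨ *-comm y (a ⊓ x) ⟩
  (a ⊓ x) * y         ≡⟨ cong ((a ⊓ x) *_) (sym (p≥q⇒p⊓q≡q y≤b)) ⟩
  (a ⊓ x) * (b ⊓ y)   ∎
  where open ≤-Reasoning

prodTo-exchange : ∀ N q {f f′ : ℕ → ℚ} → q ℕ.< N → (∀ i → i ℕ.< suc N → 0ℚ ≤ f i) →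
                  (∀ i → i ℕ.< N → i ≢ q → f (suc i) ≡ f′ (suc i)) →
                  f 0 * f (suc q) ≤ f′ 0 * f′ (suc q) → prodTo (suc N) f ≤ prodTo (suc N) f′
prodTo-exchange N q {f} {f′} q<N f≥0 same better = begin
  prodTo (suc N) f                                ≡⟨ split f ⟩
  f 0 * f (suc q) * prodTo N (dropAt tail q)      ≤⟨ *-monoʳ-≤-≥0 _ rest≥0 better ⟩
  f′ 0 * f′ (suc q) * prodTo N (dropAt tail q)    ≡⟨ cong (f′ 0 * f′ (suc q) *_) (prodTo-cong N rest≡) ⟩
  f′ 0 * f′ (suc q) * prodTo N (dropAt tail′ q)   ≡⟨ sym (split f′) ⟩
  prodTo (suc N) f′                               ∎
  where
  open ≤-Reasoning
  tail tail′ : ℕ → ℚ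
  tail  i = f (suc i)
  tail′ i = f′ (suc i)
  split : ∀ g → prodTo (suc N) g ≡ g 0 * g (suc q) * prodTo N (dropAt (λ i → g (suc i)) q)
  split g = trans (prodTo-first N g)
    (trans (cong (g 0 *_) (prodTo-extract N (λ i → g (suc i)) q q<N)) (sym (*-assoc (g 0) _ _)))
  rest≡ : ∀ i → i ℕ.< N → dropAt tail q i ≡ dropAt tail′ q i
  rest≡ i i<N with i ℕ.≟ q
  ... | yes refl = trans (dropAt-≡ tail i) (sym (dropAt-≡ tail′ i))
  ... | no i≢q   = trans (dropAt-≢ tail i≢q) (trans (same i i<N i≢q) (sym (dropAt-≢ tail′ i≢q)))
  rest≥0 : 0ℚ ≤ prodTo N (dropAt tail q)
  rest≥0 = prodTo-nonNeg N λ i i<N → dropped≥0 i (f≥0 (suc i) (s≤s i<N))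
    where
    dropped≥0 : ∀ i → 0ℚ ≤ f (suc i) → 0ℚ ≤ dropAt tail q i
    dropped≥0 i fi≥0 with i ℕ.≟ q
    ... | yes refl = ≤-trans 0≤1 (≤-reflexive (sym (dropAt-≡ tail i)))
    ... | no i≢q   = ≤-trans fi≥0 (≤-reflexive (sym (dropAt-≢ tail i≢q)))

swapFirst : ℕ → ℕ → ℕ
swapFirst q zero    = suc q
swapFirst q (suc i) = if does (i ℕ.≟ q) then 0 else suc i

swapFirst-fix : ∀ q {i} → i ≢ q → swapFirst q (suc i) ≡ suc i
swapFirst-fix q {i} i≢q = cong (λ t → if t then 0 else suc i) (dec-false (i ℕ.≟ q) i≢q)

swapFirst-hit : ∀ q → swapFirst q (suc q) ≡ 0
swapFirst-hit q = cong (λ t → if t then 0 else suc q) (dec-true (q ℕ.≟ q) refl)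

swapFirst-involutive : ∀ q i → swapFirst q (swapFirst q i) ≡ i
swapFirst-involutive q zero    = swapFirst-hit q
swapFirst-involutive q (suc i) with i ℕ.≟ q
... | yes refl = cong (swapFirst i) (swapFirst-hit i)
... | no i≢q   = trans (cong (swapFirst q) (swapFirst-fix q i≢q)) (swapFirst-fix q i≢q)

swapFirst-< : ∀ {N} q i → q ℕ.< N → i ℕ.< suc N → swapFirst q i ℕ.< suc N
swapFirst-< {N} q zero    q<N _   = s≤s q<N
swapFirst-< {N} q (suc i) q<N i<1+N with i ℕ.≟ q
... | yes refl = subst (ℕ._< suc N) (sym (swapFirst-hit i)) (s≤s z≤n)
... | no i≢q   = subst (ℕ._< suc N) (sym (swapFirst-fix q i≢q)) i<1+N

claimFirst : (ℕ → Maybe ℕ) → ℕ → Maybe ℕ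
claimFirst g zero    = just 0
claimFirst g (suc i) = g (suc i)

record BetterStart (C U : ℕ → ℚ) (d : ℚ) (g : ℕ → Maybe ℕ) (N h : ℕ) : Set where
  field
    matching′  : ℕ → Maybe ℕ
    isMatching : Matching matching′ (suc N) h
    startsBest : matching′ 0 ≡ just 0
    improves   : prodTo (suc N) (profile C U d g) ≤ prodTo (suc N) (profile C U d matching′)
open BetterStart

module _ {C U : ℕ → ℚ} {d : ℚ} (C-anti : Antitone C) (U-anti : Antitone U)
         (C≥0 : NonNeg C) (U≥0 : NonNeg U) (d≥0 : 0ℚ ≤ d) where

  swapWithHolder : ∀ N {g h j} q → Matching g (suc N) h → g 0 ≡ just j →
                   q ℕ.< N → g (suc q) ≡ just 0 → BetterStart C U d g N h
  swapWithHolder N {g} {h} {j} q m g0 q<N gq = record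
    { matching′ = g ∘ swapFirst q ; isMatching = swapped ; startsBest = gq
    ; improves = prodTo-exchange N q q<N (λ i _ → profile-nonNeg g C≥0 U≥0 d≥0 i) same better }
    where
    swapped : Matching (g ∘ swapFirst q) (suc N) h
    swapped = record
      { inRange   = λ i< e → inRange m (swapFirst-< q _ q<N i<) e
      ; injective = λ {i} {i′} i< i′< e e′ → begin
          i                              ≡⟨ sym (swapFirst-involutive q i) ⟩
          swapFirst q (swapFirst q i)    ≡⟨ cong (swapFirst q) (injective m (swapFirst-< q i q<N i<) (swapFirst-< q i′ q<N i′<) e e′) ⟩
          swapFirst q (swapFirst q i′)   ≡⟨ swapFirst-involutive q i′ ⟩
          i′                             ∎ }
      where open ≡-Reasoning
    same : ∀ i → i ℕ.< N → i ≢ q → profile C U d g (suc i) ≡ profile C U d (g ∘ swapFirst q) (suc i)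
    same i _ i≢q = cong (λ t → matchValue U d (C (suc i)) (g t)) (sym (swapFirst-fix q i≢q))
    better : profile C U d g 0 * profile C U d g (suc q)
           ≤ profile C U d (g ∘ swapFirst q) 0 * profile C U d (g ∘ swapFirst q) (suc q)
    better = subst₂ _≤_
      (sym (cong₂ _*_ (profile-just C U d g g0) (profile-just C U d g gq)))
      (sym (cong₂ _*_ (profile-just C U d (g ∘ swapFirst q) gq)
                      (profile-just C U d (g ∘ swapFirst q) (trans (cong g (swapFirst-hit q)) g0))))
      (minProduct-exchange (C≥0 (suc q)) (C-anti 0 (suc q) z≤n) (U≥0 j) (U-anti 0 j z≤n))

  takeBest : ∀ N {g h j} → Matching g (suc N) h → g 0 ≡ just j →
             ¬ (∃ λ q → q ℕ.< N × g (suc q) ≡ just 0) → BetterStart C U d g N h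
  takeBest N {g} {h} {j} m g0 nobody = record
    { matching′ = claimFirst g ; isMatching = claimed ; startsBest = refl ; improves = better }
    where
    claimed : Matching (claimFirst g) (suc N) h
    claimed = record { inRange = range ; injective = inj }
      where
      range : ∀ {i t} → i ℕ.< suc N → claimFirst g i ≡ just t → t ℕ.< h
      range {zero}  _  refl = ℕP.≤-<-trans z≤n (inRange m (s≤s z≤n) g0)
      range {suc i} i< e    = inRange m i< e
      inj : ∀ {i i′ t} → i ℕ.< suc N → i′ ℕ.< suc N → claimFirst g i ≡ just t → claimFirst g i′ ≡ just t → i ≡ i′
      inj {zero}  {zero}   _  _   _    _    = refl
      inj {zero}  {suc i′} _  i′< refl e′   = ⊥-elim (nobody (i′ , ℕP.≤-pred i′< , e′))
      inj {suc i} {zero}   i< _   e    refl = ⊥-elim (nobody (i , ℕP.≤-pred i< , e))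
      inj {suc i} {suc i′} i< i′< e    e′   = injective m i< i′< e e′
    better : prodTo (suc N) (profile C U d g) ≤ prodTo (suc N) (profile C U d (claimFirst g))
    better = begin
      prodTo (suc N) (profile C U d g)
        ≡⟨ prodTo-first N (profile C U d g) ⟩
      profile C U d g 0 * rest
        ≡⟨ cong (_* rest) (profile-just C U d g g0) ⟩
      (C 0 ⊓ U j) * rest
        ≤⟨ *-monoʳ-≤-≥0 rest rest≥0 (⊓-monoʳ-≤ (C 0) (U-anti 0 j z≤n)) ⟩
      (C 0 ⊓ U 0) * rest
        ≡⟨ sym (prodTo-first N (profile C U d (claimFirst g))) ⟩
      prodTo (suc N) (profile C U d (claimFirst g))
        ∎
      where
      open ≤-Reasoning
      rest = prodTo N (λ i → profile C U d g (suc i))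
      rest≥0 = prodTo-nonNeg N (λ i _ → profile-nonNeg g C≥0 U≥0 d≥0 (suc i))

  bestFirst : ∀ N {g h j} → Matching g (suc N) h → g 0 ≡ just j → BetterStart C U d g N h
  bestFirst N {g} m g0 with ℕP.anyUpTo? (λ q → MaybeP.≡-dec ℕ._≟_ (g (suc q)) (just 0)) N
  ... | yes (q , q<N , gq) = swapWithHolder N q m g0 q<N gq
  ... | no nobody          = takeBest N m g0 nobody

-- Goods renumbered after good 0 has been removed.
shiftDown : Maybe ℕ → Maybe ℕ
shiftDown (just (suc j)) = just j
shiftDown _              = nothing

shiftDown-just : ∀ o {j} → shiftDown o ≡ just j → o ≡ just (suc j)
shiftDown-just (just (suc j)) refl = refl

tailMatching : ∀ {g N h} → Matching g (suc N) h → Matching (g ∘ suc) N h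
tailMatching m = record { inRange = λ i< → inRange m (s≤s i<)
                        ; injective = λ i< i′< e e′ → ℕP.suc-injective (injective m (s≤s i<) (s≤s i′<) e e′) }

restMatching : ∀ {g N h} → Matching g (suc N) (suc h) → Matching (shiftDown ∘ g ∘ suc) N h
restMatching {g} m = record
  { inRange   = λ {i} i< e → ℕP.≤-pred (inRange m (s≤s i<) (shiftDown-just (g (suc i)) e))
  ; injective = λ {i} {i′} i< i′< e e′ → ℕP.suc-injective
      (injective m (s≤s i<) (s≤s i′<) (shiftDown-just (g (suc i)) e) (shiftDown-just (g (suc i′)) e′)) }

pairBound-nonNeg : ∀ C U {d} → 0ℚ ≤ d → NonNeg (pairBound C U d)
pairBound-nonNeg C U {d} d≥0 j = ≤-trans d≥0 (p≤p⊔q d (C j ⊓ U j))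

-- Induction step when agent 0 is unmatched: it contributes d on both sides.
dropUnmatched : ∀ N {C U d g h} → Antitone C → 0ℚ ≤ d → g 0 ≡ nothing →
  prodTo N (profile (C ∘ suc) U d (g ∘ suc)) * pow d h ≤ prodTo h (pairBound (C ∘ suc) U d) * pow d N →
  prodTo (suc N) (profile C U d g) * pow d h ≤ prodTo h (pairBound C U d) * pow d (suc N)
dropUnmatched N {C} {U} {d} {g} {h} C-anti d≥0 g0 rest = begin
  prodTo (suc N) (profile C U d g) * pow d h
    ≡⟨ cong (_* pow d h) (trans (prodTo-first N _) (cong (λ o → matchValue U d (C 0) o * P) g0)) ⟩
  d * P * pow d h
    ≡⟨ *-assoc d P (pow d h) ⟩
  d * (P * pow d h)
    ≤⟨ *-monoˡ-≤-≥0 d d≥0 (≤-trans rest (*-monoʳ-≤-≥0 (pow d N) (pow-nonNeg d N d≥0) shifted≤)) ⟩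
  d * (F * pow d N)
    ≡⟨ solve 3 (λ d F P → d :* (F :* P) := F :* (P :* d)) refl d F (pow d N) ⟩
  F * pow d (suc N)
    ∎
  where
  open ≤-Reasoning
  P = prodTo N (profile (C ∘ suc) U d (g ∘ suc))
  F = prodTo h (pairBound C U d)
  shifted≤ : prodTo h (pairBound (C ∘ suc) U d) ≤ F
  shifted≤ = prodTo-mono h (λ j _ → pairBound-nonNeg (C ∘ suc) U d≥0 j)
    (λ j _ → ⊔-monoʳ-≤ d (⊓-monoˡ-≤ (U j) (C-anti j (suc j) (ℕP.n≤1+n j))))

-- Induction step when agent 0 holds good 0: the pair contributes C 0 ⊓ U 0 ≤ pairBound 0.
dropFirstPair : ∀ N {C U d g h} → NonNeg C → NonNeg U → 0ℚ ≤ d →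
  Matching g (suc N) (suc h) → g 0 ≡ just 0 →
  prodTo N (profile (C ∘ suc) (U ∘ suc) d (shiftDown ∘ g ∘ suc)) * pow d h
    ≤ prodTo h (pairBound (C ∘ suc) (U ∘ suc) d) * pow d N →
  prodTo (suc N) (profile C U d g) * pow d (suc h) ≤ prodTo (suc h) (pairBound C U d) * pow d (suc N)
dropFirstPair N {C} {U} {d} {g} {h} C≥0 U≥0 d≥0 m g0 rest = begin
  prodTo (suc N) (profile C U d g) * pow d (suc h)
    ≡⟨ cong (_* pow d (suc h)) (prodTo-first N _) ⟩
  profile C U d g 0 * P * (pow d h * d)
    ≡⟨ cong (λ t → t * P * (pow d h * d)) (profile-just C U d g g0) ⟩
  (C 0 ⊓ U 0) * P * (pow d h * d)
    ≡⟨ solve 4 (λ a p q d → a :* p :* (q :* d) := a :* (p :* q) :* d) refl (C 0 ⊓ U 0) P (pow d h) d ⟩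
  (C 0 ⊓ U 0) * (P * pow d h) * d
    ≤⟨ *-monoʳ-≤-≥0 d d≥0 (*-mono-≤-≥0 (⊓-glb (C≥0 0) (U≥0 0)) (*-nonNeg P≥0 (pow-nonNeg d h d≥0)) (p≤q⊔p d _) rest′) ⟩
  pairBound C U d 0 * (F * pow d N) * d
    ≡⟨ solve 4 (λ a p q d → a :* (p :* q) :* d := a :* p :* (q :* d)) refl (pairBound C U d 0) F (pow d N) d ⟩
  pairBound C U d 0 * F * pow d (suc N)
    ≡⟨ cong (_* pow d (suc N)) (sym (prodTo-first h (pairBound C U d))) ⟩
  prodTo (suc h) (pairBound C U d) * pow d (suc N)
    ∎
  where
  open ≤-Reasoning
  P = prodTo N (λ i → profile C U d g (suc i))
  F = prodTo h (pairBound (C ∘ suc) (U ∘ suc) d)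
  P≥0 = prodTo-nonNeg N (λ i _ → profile-nonNeg g C≥0 U≥0 d≥0 (suc i))
  -- No agent other than 0 holds good 0, so renumbering the goods does not change any worth.
  renumbered : ∀ i → i ℕ.< N → profile (C ∘ suc) (U ∘ suc) d (shiftDown ∘ g ∘ suc) i ≡ profile C U d g (suc i)
  renumbered i i<N with g (suc i) in e
  ... | nothing      = refl
  ... | just (suc j) = refl
  ... | just zero    with () ← injective m (s≤s z≤n) (s≤s i<N) g0 e
  rest′ : P * pow d h ≤ F * pow d N
  rest′ = subst (λ t → t * pow d h ≤ F * pow d N) (prodTo-cong N renumbered) rest

-- By induction on N: agent 0 is either unmatched, or after an exchange (bestFirst) holds good 0.
matchingBound : ∀ N {C U d g h} → Antitone C → Antitone U → NonNeg C → NonNeg U → 0ℚ ≤ d →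
  Matching g N h → prodTo N (profile C U d g) * pow d h ≤ prodTo h (pairBound C U d) * pow d N
matchingBound zero {C} {U} {d} {g} {h} _ _ _ _ d≥0 _ = begin
  1ℚ * pow d h                      ≡⟨ *-identityˡ (pow d h) ⟩
  pow d h                           ≡⟨ sym (prodTo-const h d) ⟩
  prodTo h (λ _ → d)                ≤⟨ prodTo-mono h (λ _ _ → d≥0) (λ j _ → p≤p⊔q d (C j ⊓ U j)) ⟩
  prodTo h (pairBound C U d)        ≡⟨ sym (*-identityʳ _) ⟩
  prodTo h (pairBound C U d) * 1ℚ   ∎
  where open ≤-Reasoning
matchingBound (suc N) {C} {U} {d} {g} {h} C-anti U-anti C≥0 U≥0 d≥0 m with g 0 in g0
... | nothing = dropUnmatched N {C} {U} {d} {g} {h} C-anti d≥0 g0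
                  (matchingBound N (λ i j i≤j → C-anti (suc i) (suc j) (s≤s i≤j)) U-anti (C≥0 ∘ suc) U≥0 d≥0 (tailMatching m))
... | just j with h | m | inRange m (s≤s z≤n) g0
...   | suc h′ | m | _ = let better = bestFirst C-anti U-anti C≥0 U≥0 d≥0 N m g0 in
                 ≤-trans (*-monoʳ-≤-≥0 (pow d (suc h′)) (pow-nonNeg d (suc h′) d≥0) (improves better))
                        (dropFirstPair N C≥0 U≥0 d≥0 (isMatching better) (startsBest better)
                          (matchingBound N (λ i j i≤j → C-anti (suc i) (suc j) (s≤s i≤j))
                                           (λ i j i≤j → U-anti (suc i) (suc j) (s≤s i≤j)) (C≥0 ∘ suc) (U≥0 ∘ suc) d≥0
                                           (restMatching (isMatching better))))

-- Allocations with agents and goods numbered by ℕ: holder j is the agent owning good j.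

holds : Maybe ℕ → ℕ → Bool
holds nothing  i = false
holds (just a) i = does (a ℕ.≟ i)

holds-just : ∀ o i → holds o i ≡ true → o ≡ just i
holds-just (just a) i e = cong just (ℕP.≡ᵇ⇒≡ a i (subst T (sym e) _))

indicator : Bool → ℚ → ℚ
indicator b v = if b then v else 0ℚ

indicator-nonNeg : ∀ b {v} → 0ℚ ≤ v → 0ℚ ≤ indicator b v
indicator-nonNeg true  v≥0 = v≥0
indicator-nonNeg false _   = ≤-refl

-- A good has at most one holder, so summed over agents its value is counted at most once.
heldOnce : ∀ o N {v} → 0ℚ ≤ v → sumTo N (λ i → indicator (holds o i) v) ≤ v
heldOnce nothing  N v≥0 = ≤-trans (≤-reflexive (sumTo-zero N)) v≥0
heldOnce (just a) zero    v≥0 = v≥0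
heldOnce (just a) (suc N) {v} v≥0 with a ℕ.≟ N
... | yes refl = ≤-reflexive (begin
  sumTo a term + term a   ≡⟨ cong₂ _+_ (trans (sumTo-cong a others) (sumTo-zero a)) (self a) ⟩
  0ℚ + v                  ≡⟨ +-identityˡ v ⟩
  v                       ∎)
  where
  open ≡-Reasoning
  term : ℕ → ℚ
  term i = indicator (holds (just a) i) v
  others : ∀ i → i ℕ.< a → term i ≡ 0ℚ
  others i i<a = cong (λ t → indicator t v) (dec-false (a ℕ.≟ i) (ℕP.>⇒≢ i<a))
  self : ∀ a → indicator (holds (just a) a) v ≡ v
  self a = cong (λ t → indicator t v) (dec-true (a ℕ.≟ a) refl)
... | no a≢N = begin
  sumTo N term + term N   ≡⟨ cong (λ t → sumTo N term + indicator t v) (dec-false (a ℕ.≟ N) a≢N) ⟩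
  sumTo N term + 0ℚ       ≡⟨ +-identityʳ _ ⟩
  sumTo N term            ≤⟨ heldOnce (just a) N v≥0 ⟩
  v                       ∎
  where
  open ≤-Reasoning
  term : ℕ → ℚ
  term i = indicator (holds (just a) i) v

module Bundles (holder : ℕ → Maybe ℕ) (U : ℕ → ℚ) where

  hasGood : ℕ → ℕ → Bool
  hasGood i j = holds (holder j) i

  worth : ℕ → ℕ → ℕ → ℚ
  worth a b i = sumFromTo a b (λ j → indicator (hasGood i j) (U j))

  count : ℕ → ℕ → ℚ
  count b i = sumTo b (λ j → indicator (hasGood i j) 1ℚ)

  -- Agent i's best good below h: the least-numbered one it holds.
  best : ℕ → ℕ → Maybe ℕ
  best h i = least (hasGood i) h

  worth-split : ∀ {h M} → h ℕ.≤ M → ∀ i → worth 0 M i ≡ worth 0 h i + worth h M i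
  worth-split {h} {M} h≤M i =
    trans (cong (λ b → sumTo b (λ j → indicator (hasGood i j) (U j))) (sym (ℕP.m+[n∸m]≡n h≤M)))
          (sumTo-split h (M ∸ h) (λ j → indicator (hasGood i j) (U j)))

  worth-nonNeg : NonNeg U → ∀ a b i → 0ℚ ≤ worth a b i
  worth-nonNeg U≥0 a b i = sumTo-nonNeg (b ∸ a) (λ j _ → indicator-nonNeg (hasGood i (a ℕ.+ j)) (U≥0 (a ℕ.+ j)))

  count-nonNeg : ∀ b i → 0ℚ ≤ count b i
  count-nonNeg b i = sumTo-nonNeg b (λ j _ → indicator-nonNeg (hasGood i j) 0≤1)

  worth-total : NonNeg U → ∀ a b N → sumTo N (worth a b) ≤ sumFromTo a b U
  worth-total U≥0 a b N = ≤-trans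
    (≤-reflexive (sumTo-swap N (b ∸ a) (λ i j → indicator (hasGood i (a ℕ.+ j)) (U (a ℕ.+ j)))))
    (sumTo-mono (b ∸ a) (λ j _ → heldOnce (holder (a ℕ.+ j)) N (U≥0 (a ℕ.+ j))))

  count-total : ∀ b N → sumTo N (count b) ≤ ones b
  count-total b N = ≤-trans
    (≤-reflexive (sumTo-swap N b (λ i j → indicator (hasGood i j) 1ℚ)))
    (sumTo-mono b (λ j _ → heldOnce (holder j) N 0≤1))

  best-nothing : ∀ h i → best h i ≡ nothing → worth 0 h i ≡ 0ℚ
  best-nothing h i e = trans
    (sumTo-cong h (λ j j<h → cong (λ t → indicator t (U j)) (least-nothing (hasGood i) h e j j<h)))
    (sumTo-zero h)

  best-< : ∀ h i {g} → best h i ≡ just g → g ℕ.< h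
  best-< h i e = proj₁ (least-just (hasGood i) h e)

  best-count : ∀ h i {g} → best h i ≡ just g → 1ℚ ≤ count h i
  best-count h i {g} e with least-just (hasGood i) h e
  ... | g<h , owned , _ = subst (_≤ count h i) (cong (λ t → indicator t 1ℚ) owned)
      (sumTo-term h (λ j _ → indicator-nonNeg (hasGood i j) 0≤1) g g<h)

  -- Every top good held by i is worth at most its best one.
  best-worth : Antitone U → ∀ h i {g} → best h i ≡ just g → worth 0 h i ≤ U g * count h i
  best-worth U-anti h i {g} e with least-just (hasGood i) h e
  ... | _ , _ , before = ≤-trans (sumTo-mono h term≤)
        (≤-reflexive (sumTo-scale h (U g) (λ j → indicator (hasGood i j) 1ℚ)))
    where
    term≤ : ∀ j → j ℕ.< h → indicator (hasGood i j) (U j) ≤ U g * indicator (hasGood i j) 1ℚ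
    term≤ j _ with hasGood i j in o
    ... | false = ≤-reflexive (sym (*-zeroʳ (U g)))
    ... | true with j ℕ.<? g
    ...   | yes j<g = ⊥-elim (true≢false (trans (sym o) (before j j<g)))
      where true≢false : true ≢ false
            true≢false ()
    ...   | no j≮g  = ≤-trans (U-anti g j (ℕP.≮⇒≥ j≮g)) (≤-reflexive (sym (*-identityʳ (U g))))

  -- Distinct agents have distinct best goods: best is a matching into the goods below h.
  best-matching : ∀ N h → Matching (best h) N h
  best-matching N h = record
    { inRange   = λ {i} _ e → best-< h i e
    ; injective = λ {i} {i′} {g} _ _ e e′ → just-injective (trans (sym (holds-just (holder g) i (heldBy e)))
                                                                  (holds-just (holder g) i′ (heldBy e′))) }
    where
    heldBy : ∀ {i g} → best h i ≡ just g → hasGood i g ≡ true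
    heldBy {i} e = proj₁ (proj₂ (least-just (hasGood i) h e))
    just-injective : ∀ {a b : ℕ} → just a ≡ just b → a ≡ b
    just-injective refl = refl

-- For an agent with utility w = min(cap, bundle value), split its
-- bundle into the top goods (value tp, cn of them) and the remaining goods (value lo); the
-- agent's benchmark s and allowance lo + δ·cn + slack satisfy w·δ ≤ s·allowance.

≤-+-nonNeg : ∀ {a b} → 0ℚ ≤ b → a ≤ a + b
≤-+-nonNeg {a} {b} b≥0 = ≤-trans (≤-reflexive (sym (+-identityʳ a))) (+-monoʳ-≤ a b≥0)

p≤q⇒0≤q-p : ∀ {p q} → p ≤ q → 0ℚ ≤ q - p
p≤q⇒0≤q-p {p} {q} p≤q = ≤-trans (≤-reflexive (sym (+-inverseʳ p))) (+-monoˡ-≤ (- p) p≤q)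

-- An agent without a top good (benchmark δ) whose utility comes from the other goods.
unmatchedBound : ∀ {w lo cn δ} → 0ℚ ≤ δ → 0ℚ ≤ cn → w ≤ lo → w * δ ≤ δ * (lo + δ * cn + 0ℚ)
unmatchedBound {w} {lo} {cn} {δ} δ≥0 cn≥0 w≤lo = begin
  w * δ
    ≤⟨ *-monoʳ-≤-≥0 δ δ≥0 w≤lo ⟩
  lo * δ
    ≡⟨ *-comm lo δ ⟩
  δ * lo
    ≤⟨ *-monoˡ-≤-≥0 δ δ≥0 (≤-trans (≤-+-nonNeg (*-nonNeg δ≥0 cn≥0)) (≤-+-nonNeg ≤-refl)) ⟩
  δ * (lo + δ * cn + 0ℚ)
    ∎
  where open ≤-Reasoning

-- An agent whose best top good has utility ug (benchmark c ⊓ ug), with δ below both.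
matchedBound : ∀ {w c tp lo cn δ ug} → 0ℚ ≤ δ → δ ≤ c → δ ≤ ug → 0ℚ ≤ lo → 1ℚ ≤ cn →
               w ≤ c → w ≤ tp + lo → tp ≤ ug * cn → w * δ ≤ (c ⊓ ug) * (lo + δ * cn + 0ℚ)
matchedBound {w} {c} {tp} {lo} {cn} {δ} {ug} δ≥0 δ≤c δ≤ug lo≥0 cn≥1 w≤c w≤tp+lo tp≤ with ≤-total c ug
... | inj₁ c≤ug = begin
  w * δ
    ≤⟨ *-monoʳ-≤-≥0 δ δ≥0 w≤c ⟩
  c * δ
    ≤⟨ *-monoˡ-≤-≥0 c c≥0 δ≤δcn ⟩
  c * (δ * cn)
    ≤⟨ *-monoˡ-≤-≥0 c c≥0 (≤-trans (≤-trans (≤-+-nonNeg lo≥0) (≤-reflexive (+-comm (δ * cn) lo))) (≤-+-nonNeg ≤-refl)) ⟩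
  c * (lo + δ * cn + 0ℚ)
    ≡⟨ cong (_* _) (sym (p≤q⇒p⊓q≡p c≤ug)) ⟩
  (c ⊓ ug) * (lo + δ * cn + 0ℚ)
    ∎
  where
  open ≤-Reasoning
  c≥0 = ≤-trans δ≥0 δ≤c
  δ≤δcn : δ ≤ δ * cn
  δ≤δcn = ≤-trans (≤-reflexive (sym (*-identityʳ δ))) (*-monoˡ-≤-≥0 δ δ≥0 cn≥1)
... | inj₂ ug≤c = begin
  w * δ
    ≤⟨ *-monoʳ-≤-≥0 δ δ≥0 (≤-trans w≤tp+lo (+-monoˡ-≤ lo tp≤)) ⟩
  (ug * cn + lo) * δ
    ≡⟨ solve 4 (λ u c l d → (u :* c :+ l) :* d := u :* (d :* c) :+ l :* d) refl ug cn lo δ ⟩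
  ug * (δ * cn) + lo * δ
    ≤⟨ +-monoʳ-≤ (ug * (δ * cn)) (*-monoˡ-≤-≥0 lo lo≥0 δ≤ug) ⟩
  ug * (δ * cn) + lo * ug
    ≡⟨ solve 4 (λ u c l d → u :* (d :* c) :+ l :* u := u :* (l :+ d :* c :+ con 0ℚ)) refl ug cn lo δ ⟩
  ug * (lo + δ * cn + 0ℚ)
    ≡⟨ cong (_* _) (sym (p≥q⇒p⊓q≡q ug≤c)) ⟩
  (c ⊓ ug) * (lo + δ * cn + 0ℚ)
    ∎
  where open ≤-Reasoning

-- An agent with cap c ≤ δ (benchmark c), whose allowance carries the slack δ − c.
tailBound : ∀ {w c lo cn δ} → 0ℚ ≤ c → c ≤ δ → w ≤ c → w ≤ lo + δ * cn →
            w * δ ≤ c * (lo + δ * cn + (δ - c))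
tailBound {w} {c} {lo} {cn} {δ} c≥0 c≤δ w≤c w≤ = begin
  w * δ
    ≡⟨ solve 3 (λ w c d → w :* d := c :* w :+ (d :- c) :* w) refl w c δ ⟩
  c * w + (δ - c) * w
    ≤⟨ +-mono-≤ (*-monoˡ-≤-≥0 c c≥0 w≤) (*-monoˡ-≤-≥0 (δ - c) (p≤q⇒0≤q-p c≤δ) w≤c) ⟩
  c * (lo + δ * cn) + (δ - c) * c
    ≡⟨ solve 4 (λ c l n d → c :* (l :+ d :* n) :+ (d :- c) :* c := c :* (l :+ d :* n :+ (d :- c))) refl c lo cn δ ⟩
  c * (lo + δ * cn + (δ - c))
    ∎
  where open ≤-Reasoning

ones-mono : ∀ {a b} → a ℕ.≤ b → ones a ≤ ones b
ones-mono {a} {b} a≤b = begin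
  ones a                      ≤⟨ ≤-+-nonNeg (ones-nonNeg (b ∸ a)) ⟩
  ones a + ones (b ∸ a)       ≡⟨ sym (ones-+ a (b ∸ a)) ⟩
  ones (a ℕ.+ (b ∸ a))        ≡⟨ cong ones (ℕP.m+[n∸m]≡n a≤b) ⟩
  ones b                      ∎
  where open ≤-Reasoning

ones-< : ∀ {a b} → a ℕ.< b → ones a < ones b
ones-< {a} {suc b} (s≤s a≤b) =
  ≤-<-trans (ones-mono a≤b) (≤-<-trans (≤-reflexive (sym (+-identityʳ (ones b)))) (+-monoʳ-< (ones b) 0<1))

<⇒≤∸1 : ∀ {i b} → i ℕ.< b → i ℕ.≤ b ∸ 1
<⇒≤∸1 (s≤s i≤b′) = i≤b′

module Core
  (n M h k : ℕ) (C U : ℕ → ℚ) (holder : ℕ → Maybe ℕ)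
  (C-anti : Antitone C) (U-anti : Antitone U) (C≥0 : NonNeg C) (U≥0 : NonNeg U)
  (h<N : h ℕ.< n ∸ k) (h≤M : h ℕ.≤ M)
  (δ : ℚ) (δ-def : δ ≡ (sumFromTo h M U - sumFromTo (n ∸ k) n C) * inv (n ∸ h ∸ k))
  (tail≤δ : 1 ℕ.≤ k → C (n ∸ k) ≤ δ) (δ<C : δ < C (n ∸ k ∸ 1)) (δ<U : 1 ℕ.≤ h → δ < U (h ∸ 1))
  where

  open Bundles holder U

  N K m : ℕ
  N = n ∸ k
  K = n ∸ N
  m = n ∸ h ∸ k

  n≡N+K : n ≡ N ℕ.+ K
  n≡N+K = sym (ℕP.m+[n∸m]≡n (ℕP.m∸n≤m n k))

  N≡h+m : N ≡ h ℕ.+ m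
  N≡h+m = sym (trans (cong (h ℕ.+_) m≡N∸h) (ℕP.m+[n∸m]≡n (ℕP.<⇒≤ h<N)))
    where
    m≡N∸h : m ≡ N ∸ h
    m≡N∸h = trans (ℕP.∸-+-assoc n h k) (trans (cong (n ∸_) (ℕP.+-comm h k)) (sym (ℕP.∸-+-assoc n k h)))

  m-pos : ∃ λ m′ → m ≡ suc m′
  m-pos with m | N≡h+m
  ... | zero  | N≡h+0 = ⊥-elim (ℕP.<-irrefl (trans (sym (ℕP.+-identityʳ h)) (sym N≡h+0)) h<N)
  ... | suc m′ | _    = m′ , refl

  δ<C-head : ∀ {i} → i ℕ.< N → δ < C i
  δ<C-head {i} i<N = <-≤-trans δ<C (C-anti i (N ∸ 1) (<⇒≤∸1 i<N))

  δ<U-top : ∀ {j} → j ℕ.< h → δ < U j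
  δ<U-top {j} j<h = <-≤-trans (δ<U (ℕP.≤-trans (s≤s z≤n) j<h)) (U-anti j (h ∸ 1) (<⇒≤∸1 j<h))

  C≤δ-tail : ∀ {i} → N ℕ.≤ i → i ℕ.< n → C i ≤ δ
  C≤δ-tail {i} N≤i i<n = ≤-trans (C-anti N i N≤i) (tail≤δ (ℕP.n≢0⇒n>0 k≢0))
    where
    k≢0 : k ≢ 0
    k≢0 k≡0 = ℕP.<-irrefl refl (ℕP.≤-<-trans (subst (ℕ._≤ i) (cong (n ∸_) k≡0) N≤i) i<n)

  Ut Ct : ℚ
  Ut = sumFromTo h M U
  Ct = sumFromTo N n C

  δ≥0 : 0ℚ ≤ δ
  δ≥0 with k ℕ.≟ 0
  ... | no k≢0  = ≤-trans (C≥0 N) (tail≤δ (ℕP.n≢0⇒n>0 k≢0))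
  ... | yes k≡0 = subst (0ℚ ≤_) (sym δ-def) (*-nonNeg Ut-Ct≥0 (inv-nonNeg m))
    where
    Ct≡0 : Ct ≡ 0ℚ
    Ct≡0 = cong (λ t → sumTo t (λ i → C (N ℕ.+ i))) (trans (cong (λ k → n ∸ (n ∸ k)) k≡0) (ℕP.n∸n≡0 n))
    Ut-Ct≥0 : 0ℚ ≤ Ut - Ct
    Ut-Ct≥0 = subst (λ t → 0ℚ ≤ Ut - t) (sym Ct≡0)
      (subst (0ℚ ≤_) (sym (+-identityʳ Ut)) (sumTo-nonNeg (M ∸ h) (λ j _ → U≥0 (h ℕ.+ j))))

  mδ≡ : ones m * δ ≡ Ut - Ct
  mδ≡ with m-pos
  ... | m′ , m≡ = trans (cong (ones m *_) δ-def)
                        (subst (λ t → ones t * ((Ut - Ct) * inv t) ≡ Ut - Ct) (sym m≡) (ones-cancel m′ (Ut - Ct)))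

  W : ℕ → ℚ
  W i = C i ⊓ worth 0 M i

  benchmark slack allowance : ℕ → ℚ
  benchmark = piecewise N (profile C U δ (best h)) C
  slack     = piecewise N (λ _ → 0ℚ) (λ i → δ - C i)
  allowance i = worth h M i + δ * count h i + slack i

  benchmark-head : ∀ {i} → i ℕ.< N → benchmark i ≡ matchValue U δ (C i) (best h i)
  benchmark-head = piecewise-< N (profile C U δ (best h)) C

  benchmark-tail : ∀ {i} → N ℕ.≤ i → benchmark i ≡ C i
  benchmark-tail = piecewise-≥ N (profile C U δ (best h)) C

  slack-head : ∀ {i} → i ℕ.< N → slack i ≡ 0ℚ
  slack-head = piecewise-< N (λ _ → 0ℚ) (λ i → δ - C i)

  slack-tail : ∀ {i} → N ℕ.≤ i → slack i ≡ δ - C i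
  slack-tail = piecewise-≥ N (λ _ → 0ℚ) (λ i → δ - C i)

  W≥0 : ∀ i → 0ℚ ≤ W i
  W≥0 i = ⊓-glb (C≥0 i) (worth-nonNeg U≥0 0 M i)

  W≤worth : ∀ i → W i ≤ worth 0 h i + worth h M i
  W≤worth i = ≤-trans (p⊓q≤q (C i) _) (≤-reflexive (worth-split h≤M i))

  W≤rest : ∀ i → best h i ≡ nothing → W i ≤ worth h M i
  W≤rest i e = ≤-trans (W≤worth i) (≤-reflexive (trans (cong (_+ worth h M i) (best-nothing h i e)) (+-identityˡ _)))

  slack≥0 : ∀ i → i ℕ.< n → 0ℚ ≤ slack i
  slack≥0 i i<n with i ℕ.<? N
  ... | yes i<N = ≤-reflexive (sym (slack-head i<N))
  ... | no  i≮N = ≤-trans (p≤q⇒0≤q-p (C≤δ-tail (ℕP.≮⇒≥ i≮N) i<n)) (≤-reflexive (sym (slack-tail (ℕP.≮⇒≥ i≮N))))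

  allowance≥0 : ∀ i → i ℕ.< n → 0ℚ ≤ allowance i
  allowance≥0 i i<n = +-mono-≤ (+-mono-≤ (worth-nonNeg U≥0 h M i) (*-nonNeg δ≥0 (count-nonNeg h i))) (slack≥0 i i<n)

  benchmark≥0 : ∀ i → 0ℚ ≤ benchmark i
  benchmark≥0 i with i ℕ.<? N
  ... | yes i<N = ≤-trans (profile-nonNeg (best h) C≥0 U≥0 δ≥0 i) (≤-reflexive (sym (benchmark-head i<N)))
  ... | no  i≮N = ≤-trans (C≥0 i) (≤-reflexive (sym (benchmark-tail (ℕP.≮⇒≥ i≮N))))

  allowance-head : ∀ {i} → i ℕ.< N → allowance i ≡ worth h M i + δ * count h i + 0ℚ
  allowance-head {i} i<N = cong (λ t → worth h M i + δ * count h i + t) (slack-head i<N)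

  allowance-tail : ∀ {i} → N ℕ.≤ i → allowance i ≡ worth h M i + δ * count h i + (δ - C i)
  allowance-tail {i} N≤i = cong (λ t → worth h M i + δ * count h i + t) (slack-tail N≤i)

  headAgent : ∀ {i} → i ℕ.< N → W i * δ ≤ benchmark i * allowance i
  headAgent {i} i<N = begin
    W i * δ
      ≤⟨ byBestGood (best h i) refl ⟩
    matchValue U δ (C i) (best h i) * (worth h M i + δ * count h i + 0ℚ)
      ≡⟨ sym (cong₂ _*_ (benchmark-head i<N) (allowance-head i<N)) ⟩
    benchmark i * allowance i
      ∎
    where
    open ≤-Reasoning
    byBestGood : ∀ b → best h i ≡ b → W i * δ ≤ matchValue U δ (C i) b * (worth h M i + δ * count h i + 0ℚ)
    byBestGood nothing  e = unmatchedBound δ≥0 (count-nonNeg h i) (W≤rest i e)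
    byBestGood (just g) e = matchedBound δ≥0 (<⇒≤ (δ<C-head i<N)) (<⇒≤ (δ<U-top (best-< h i e)))
                              (worth-nonNeg U≥0 h M i) (best-count h i e)
                              (p⊓q≤p (C i) _) (W≤worth i) (best-worth U-anti h i e)

  tailAgent : ∀ {i} → N ℕ.≤ i → i ℕ.< n → W i * δ ≤ benchmark i * allowance i
  tailAgent {i} N≤i i<n = begin
    W i * δ
      ≤⟨ tailBound {lo = worth h M i} {cn = count h i} (C≥0 i) (C≤δ-tail N≤i i<n) (p⊓q≤p (C i) _) (W≤allowance (best h i) refl) ⟩
    C i * (worth h M i + δ * count h i + (δ - C i))
      ≡⟨ sym (cong₂ _*_ (benchmark-tail N≤i) (allowance-tail N≤i)) ⟩
    benchmark i * allowance i
      ∎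
    where
    open ≤-Reasoning
    -- Either i has no top good, or a single top good already pays for its cap C i ≤ δ.
    W≤allowance : ∀ b → best h i ≡ b → W i ≤ worth h M i + δ * count h i
    W≤allowance nothing  e = ≤-trans (W≤rest i e) (≤-+-nonNeg (*-nonNeg δ≥0 (count-nonNeg h i)))
    W≤allowance (just g) e = begin
      W i
        ≤⟨ p⊓q≤p (C i) _ ⟩
      C i
        ≤⟨ C≤δ-tail N≤i i<n ⟩
      δ
        ≡⟨ sym (*-identityʳ δ) ⟩
      δ * 1ℚ
        ≤⟨ *-monoˡ-≤-≥0 δ δ≥0 (best-count h i e) ⟩
      δ * count h i
        ≤⟨ ≤-trans (≤-+-nonNeg (worth-nonNeg U≥0 h M i)) (≤-reflexive (+-comm (δ * count h i) (worth h M i))) ⟩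
      worth h M i + δ * count h i
        ∎

  agentBound : ∀ i → i ℕ.< n → W i * δ ≤ benchmark i * allowance i
  agentBound i i<n with i ℕ.<? N
  ... | yes i<N = headAgent i<N
  ... | no  i≮N = tailAgent (ℕP.≮⇒≥ i≮N) i<n

  -- Summing the allowances: the non-top goods give at most Ut, the top goods at most h·δ and
  -- the slacks k·δ − Ct; by the choice of δ this is exactly n·δ.
  slack-total : sumTo n slack ≡ ones K * δ - Ct
  slack-total = begin
    sumTo n slack
      ≡⟨ cong (λ t → sumTo t slack) n≡N+K ⟩
    sumTo (N ℕ.+ K) slack
      ≡⟨ sumTo-piecewise N K (λ _ → 0ℚ) (λ i → δ - C i) ⟩
    sumTo N (λ _ → 0ℚ) + sumTo K (λ i → δ - C (N ℕ.+ i))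
      ≡⟨ cong₂ _+_ (sumTo-zero N) (sumTo-+ K (λ _ → δ) (λ i → - C (N ℕ.+ i))) ⟩
    0ℚ + (sumTo K (λ _ → δ) + sumTo K (λ i → - C (N ℕ.+ i)))
      ≡⟨ +-identityˡ _ ⟩
    sumTo K (λ _ → δ) + sumTo K (λ i → - C (N ℕ.+ i))
      ≡⟨ cong₂ _+_ (sumTo-const K δ) (sumTo-neg K (λ i → C (N ℕ.+ i))) ⟩
    ones K * δ - Ct
      ∎
    where open ≡-Reasoning

  ones-n : ones n ≡ ones h + ones m + ones K
  ones-n = trans (cong ones n≡N+K) (trans (ones-+ N K) (cong (_+ ones K) (trans (cong ones N≡h+m) (ones-+ h m))))

  allowance-total : sumTo n allowance ≤ ones n * δ
  allowance-total = begin
    sumTo n allowance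
      ≡⟨ split ⟩
    sumTo n (worth h M) + δ * sumTo n (count h) + sumTo n slack
      ≤⟨ +-mono-≤ (+-mono-≤ (worth-total U≥0 h M n) (*-monoˡ-≤-≥0 δ δ≥0 (count-total h n))) (≤-reflexive slack-total) ⟩
    Ut + δ * ones h + (ones K * δ - Ct)
      ≡⟨ cong (λ t → t + δ * ones h + (ones K * δ - Ct)) Ut≡ ⟩
    ones m * δ + Ct + δ * ones h + (ones K * δ - Ct)
      ≡⟨ solve 5 (λ a b c d e → a :* d :+ e :+ d :* b :+ (c :* d :- e) := (b :+ a :+ c) :* d) refl (ones m) (ones h) (ones K) δ Ct ⟩
    (ones h + ones m + ones K) * δ
      ≡⟨ cong (_* δ) (sym ones-n) ⟩
    ones n * δ
      ∎
    where
    open ≤-Reasoning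
    split : sumTo n allowance ≡ sumTo n (worth h M) + δ * sumTo n (count h) + sumTo n slack
    split = trans (sumTo-+ n (λ i → worth h M i + δ * count h i) slack)
      (cong (_+ sumTo n slack) (trans (sumTo-+ n (worth h M) (λ i → δ * count h i)) (cong (sumTo n (worth h M) +_) (sumTo-scale n δ (count h)))))
    Ut≡ : Ut ≡ ones m * δ + Ct
    Ut≡ = trans (solve 2 (λ u c → u := (u :- c) :+ c) refl Ut Ct) (cong (_+ Ct) (sym mδ≡))

  F Pt : ℚ
  F  = prodTo h (λ i → C i ⊓ U i)
  Pt = prodFromTo N n C

  -- For δ > 0: multiply  W i · δ ≤ benchmark i · allowance i  over all agents and apply AM–GM
  -- to the allowances, whose sum is at most n·δ.
  W≤benchmark : 0ℚ < δ → prodTo n W ≤ prodTo n benchmark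
  W≤benchmark δ>0 = *-cancelʳ-≤-pos′ (pow δ n) (pow-pos δ n δ>0) (begin
    prodTo n W * pow δ n
      ≡⟨ cong (prodTo n W *_) (sym (prodTo-const n δ)) ⟩
    prodTo n W * prodTo n (λ _ → δ)
      ≡⟨ sym (prodTo-* n W (λ _ → δ)) ⟩
    prodTo n (λ i → W i * δ)
      ≤⟨ prodTo-mono n (λ i _ → *-nonNeg (W≥0 i) δ≥0) agentBound ⟩
    prodTo n (λ i → benchmark i * allowance i)
      ≡⟨ prodTo-* n benchmark allowance ⟩
    prodTo n benchmark * prodTo n allowance
      ≤⟨ *-monoˡ-≤-≥0 _ (prodTo-nonNeg n (λ i _ → benchmark≥0 i))
                        (amgm-bound n allowance δ allowance≥0 δ≥0 allowance-total) ⟩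
    prodTo n benchmark * pow δ n
      ∎)
    where open ≤-Reasoning

  -- The benchmarks of the head agents are bounded by the rearrangement bound; those of the
  -- tail agents are their caps.
  benchmark-split : prodTo n benchmark ≡ prodTo N (profile C U δ (best h)) * Pt
  benchmark-split = trans (cong (λ t → prodTo t benchmark) n≡N+K) (prodTo-piecewise N K (profile C U δ (best h)) C)

  headProfile≤ : 0ℚ < δ → prodTo N (profile C U δ (best h)) ≤ F * pow δ m
  headProfile≤ δ>0 = *-cancelʳ-≤-pos′ (pow δ h) (pow-pos δ h δ>0) (begin
    prodTo N (profile C U δ (best h)) * pow δ h
      ≤⟨ matchingBound N C-anti U-anti C≥0 U≥0 δ≥0 (best-matching N h) ⟩
    prodTo h (pairBound C U δ) * pow δ N
      ≡⟨ cong₂ _*_ (prodTo-cong h pairBound≡) (trans (cong (pow δ) N≡h+m) (pow-+ δ h m)) ⟩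
    F * (pow δ h * pow δ m)
      ≡⟨ solve 3 (λ f a b → f :* (a :* b) := f :* b :* a) refl F (pow δ h) (pow δ m) ⟩
    F * pow δ m * pow δ h
      ∎)
    where
    open ≤-Reasoning
    pairBound≡ : ∀ j → j ℕ.< h → pairBound C U δ j ≡ C j ⊓ U j
    pairBound≡ j j<h = p≤q⇒p⊔q≡q (⊓-glb (<⇒≤ (δ<C-head (ℕP.<-trans j<h h<N))) (<⇒≤ (δ<U-top j<h)))

  positiveCase : 0ℚ < δ → prodTo n W ≤ F * pow δ m * Pt
  positiveCase δ>0 = begin
    prodTo n W
      ≤⟨ W≤benchmark δ>0 ⟩
    prodTo n benchmark
      ≡⟨ benchmark-split ⟩
    prodTo N (profile C U δ (best h)) * Pt
      ≤⟨ *-monoʳ-≤-≥0 Pt (prodTo-nonNeg K (λ i _ → C≥0 (N ℕ.+ i))) (headProfile≤ δ>0) ⟩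
    F * pow δ m * Pt
      ∎
    where open ≤-Reasoning

  -- Pigeonhole: the h top goods cannot serve all n > h agents.
  someUnmatched : ∃ λ i → i ℕ.< n × best h i ≡ nothing
  someUnmatched with ℕP.anyUpTo? (λ i → MaybeP.≡-dec ℕ._≟_ (best h i) nothing) n
  ... | yes found = found
  ... | no  none  = ⊥-elim (<-irrefl refl (<-≤-trans (ones-< h<n) (≤-trans (sumTo-mono n allHold) (count-total h n))))
    where
    h<n : h ℕ.< n
    h<n = ℕP.<-≤-trans h<N (ℕP.m∸n≤m n k)
    allHold : ∀ i → i ℕ.< n → 1ℚ ≤ count h i
    allHold i i<n with best h i in e
    ... | nothing = ⊥-elim (none (i , i<n , e))
    ... | just _  = best-count h i e

  -- For δ = 0: an agent without a top good has W i ≤ allowance i ≤ n·δ = 0, and so does the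
  -- right-hand side since m ≥ 1.
  zeroCase : δ ≡ 0ℚ → prodTo n W ≤ F * pow δ m * Pt
  zeroCase δ≡0 with someUnmatched | m-pos
  ... | i , i<n , e | m′ , m≡ = ≤-reflexive (trans (prodTo-zero n i i<n Wi≡0) (sym rhs≡0))
    where
    open ≤-Reasoning
    Wi≤0 : W i ≤ 0ℚ
    Wi≤0 = begin
      W i                             ≤⟨ W≤rest i e ⟩
      worth h M i                     ≤⟨ ≤-+-nonNeg (*-nonNeg δ≥0 (count-nonNeg h i)) ⟩
      worth h M i + δ * count h i     ≤⟨ ≤-+-nonNeg (slack≥0 i i<n) ⟩
      allowance i                     ≤⟨ sumTo-term n allowance≥0 i i<n ⟩
      sumTo n allowance               ≤⟨ allowance-total ⟩
      ones n * δ                      ≡⟨ trans (cong (ones n *_) δ≡0) (*-zeroʳ (ones n)) ⟩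
      0ℚ                              ∎
    Wi≡0 : W i ≡ 0ℚ
    Wi≡0 = ≤-antisym Wi≤0 (W≥0 i)
    rhs≡0 : F * pow δ m * Pt ≡ 0ℚ
    rhs≡0 = begin-equality
      F * pow δ m * Pt                ≡⟨ cong (λ t → F * pow t m * Pt) δ≡0 ⟩
      F * pow 0ℚ m * Pt               ≡⟨ cong (λ t → F * pow 0ℚ t * Pt) m≡ ⟩
      F * (pow 0ℚ m′ * 0ℚ) * Pt       ≡⟨ cong (λ t → F * t * Pt) (*-zeroʳ (pow 0ℚ m′)) ⟩
      F * 0ℚ * Pt                     ≡⟨ cong (_* Pt) (*-zeroʳ F) ⟩
      0ℚ * Pt                         ≡⟨ *-zeroˡ Pt ⟩
      0ℚ                              ∎

  bound : prodTo n W ≤ F * pow δ m * Pt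
  bound with <-cmp 0ℚ δ
  ... | tri< δ>0 _ _   = positiveCase δ>0
  ... | tri≈ _ 0≡δ _   = zeroCase (sym 0≡δ)
  ... | tri> _ _ δ<0   = ⊥-elim (<-irrefl refl (<-≤-trans δ<0 δ≥0))

atOr : ∀ {A : Set} → A → ∀ {m} → (Fin m → A) → ℕ → A
atOr a {zero}  f _       = a
atOr a {suc m} f zero    = f Fin.zero
atOr a {suc m} f (suc i) = atOr a (f ∘ Fin.suc) i

at-zip : ∀ {A : Set} {m} (G : A → ℚ → ℚ) (a : A) → G a 0ℚ ≡ 0ℚ → (x : Fin m → A) (f : Fin m → ℚ) →
         ∀ j → at (λ j → G (x j) (f j)) j ≡ G (atOr a x j) (at f j)
at-zip {m = zero}  G a G00 x f j       = sym G00
at-zip {m = suc m} G a G00 x f zero    = refl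
at-zip {m = suc m} G a G00 x f (suc j) = at-zip G a G00 (x ∘ Fin.suc) (f ∘ Fin.suc) j

at-< : ∀ {m} (f : Fin m → ℚ) {j} (j<m : j ℕ.< m) → at f j ≡ f (Fin.fromℕ< j<m)
at-< {suc m} f {zero}  _         = refl
at-< {suc m} f {suc j} (s≤s j<m) = at-< (f ∘ Fin.suc) j<m

at-≥ : ∀ {m} (f : Fin m → ℚ) {j} → m ℕ.≤ j → at f j ≡ 0ℚ
at-≥ {zero}  f _         = refl
at-≥ {suc m} f (s≤s m≤j) = at-≥ (f ∘ Fin.suc) m≤j

sumFin-at : ∀ {m} (f : Fin m → ℚ) → sumFin f ≡ sumTo m (at f)
sumFin-at {zero}  f = refl
sumFin-at {suc m} f = trans (cong (f Fin.zero +_) (sumFin-at (f ∘ Fin.suc))) (sym (sumTo-first m (at f)))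

prodFin-at : ∀ {m} (f : Fin m → ℚ) → prodFin f ≡ prodTo m (at f)
prodFin-at {zero}  f = refl
prodFin-at {suc m} f = trans (cong (f Fin.zero *_) (prodFin-at (f ∘ Fin.suc))) (sym (prodTo-first m (at f)))

at-nonNeg : ∀ {m} (f : Fin m → ℚ) → (∀ i → 0ℚ ≤ f i) → NonNeg (at f)
at-nonNeg {m} f f≥0 j with j ℕ.<? m
... | yes j<m = ≤-trans (f≥0 _) (≤-reflexive (sym (at-< f j<m)))
... | no  j≮m = ≤-reflexive (sym (at-≥ f (ℕP.≮⇒≥ j≮m)))

at-antitone : ∀ {m} (f : Fin m → ℚ) → (∀ i j → i Fin.≤ j → f j ≤ f i) → (∀ i → 0ℚ ≤ f i) → Antitone (at f)
at-antitone {m} f f-anti f≥0 i j i≤j with j ℕ.<? m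
... | no  j≮m = ≤-trans (≤-reflexive (at-≥ f (ℕP.≮⇒≥ j≮m))) (at-nonNeg f f≥0 i)
... | yes j<m = subst₂ _≤_ (sym (at-< f j<m)) (sym (at-< f i<m))
                  (f-anti _ _ (subst₂ ℕ._≤_ (sym (FinP.toℕ-fromℕ< i<m)) (sym (FinP.toℕ-fromℕ< j<m)) i≤j))
  where i<m = ℕP.≤-<-trans i≤j j<m

holderOf : ∀ {n M} → Allocation n M → ℕ → Maybe ℕ
holderOf x j = Maybe.map Fin.toℕ (atOr nothing x j)

owns-holds : ∀ {n} (o : Maybe (Fin n)) {i} (i<n : i ℕ.< n) → owns o (Fin.fromℕ< i<n) ≡ holds (Maybe.map Fin.toℕ o) i
owns-holds nothing  i<n = refl
owns-holds (just a) {i} i<n with a Fin.≟ Fin.fromℕ< i<n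
... | yes a≡i = sym (dec-true (Fin.toℕ a ℕ.≟ i) (trans (cong Fin.toℕ a≡i) (FinP.toℕ-fromℕ< i<n)))
... | no  a≢i = sym (dec-false (Fin.toℕ a ℕ.≟ i) (λ e → a≢i (FinP.toℕ-injective (trans e (sym (FinP.toℕ-fromℕ< i<n))))))

nswPow-at : ∀ {n M} (c : Fin n → ℚ) (u : Fin M → ℚ) (x : Allocation n M) →
            nswPow c u x ≡ prodTo n (λ i → at c i ⊓ Bundles.worth (holderOf x) (at u) 0 M i)
nswPow-at {n} {M} c u x = trans (prodFin-at (λ i → c i ⊓ bundleValue u x i)) (prodTo-cong n agent)
  where
  agent : ∀ i → i ℕ.< n → at (λ i → c i ⊓ bundleValue u x i) i ≡ at c i ⊓ Bundles.worth (holderOf x) (at u) 0 M i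
  agent i i<n = trans (at-< _ i<n) (cong₂ _⊓_ (sym (at-< c i<n)) bundle)
    where
    I = Fin.fromℕ< i<n
    bundle : bundleValue u x I ≡ Bundles.worth (holderOf x) (at u) 0 M i
    bundle = trans (sumFin-at (λ j → if owns (x j) I then u j else 0ℚ)) (sumTo-cong M (λ j _ →
      trans (at-zip (λ o v → if owns o I then v else 0ℚ) nothing refl x u j)
            (cong (λ t → indicator t (at u j)) (owns-holds (atOr nothing x j) i<n))))

mainTheorem11 : (n M : ℕ) (c : Fin n → ℚ) (u : Fin M → ℚ) →
    (∀ i j → i Fin.≤ j → c j ≤ c i) → (∀ i → 0ℚ < c i) →
    (∀ i j → i Fin.≤ j → u j ≤ u i) → (∀ j → 0ℚ ≤ u j) →
    (xss : Allocation n M) → (∀ x → nswPow c u x ≤ nswPow c u xss) →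
    (h k : ℕ) → h ℕ.< n ∸ k → h ℕ.≤ M →
    let δ = (sumFromTo h M (at u) - sumFromTo (n ∸ k) n (at c)) * inv (n ∸ h ∸ k) in
    (1 ℕ.≤ k → at c (n ∸ k) ≤ δ) →
    δ < at c (n ∸ k ∸ 1) →
    (1 ℕ.≤ h → δ < at u (h ∸ 1)) →
    nswPow c u xss ≤ prodTo h (λ i → at c i ⊓ at u i) * pow δ (n ∸ h ∸ k) * prodFromTo (n ∸ k) n (at c)
mainTheorem11 n M c u c-anti c>0 u-anti u≥0 xss _ h k h<N h≤M tail≤δ δ<C δ<U = begin
  nswPow c u xss
    ≡⟨ nswPow-at c u xss ⟩
  prodTo n (λ i → at c i ⊓ Bundles.worth (holderOf xss) (at u) 0 M i)
    ≤⟨ Core.bound n M h k (at c) (at u) (holderOf xss)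
                  (at-antitone c c-anti c≥0) (at-antitone u u-anti u≥0) (at-nonNeg c c≥0) (at-nonNeg u u≥0)
                  h<N h≤M _ refl tail≤δ δ<C δ<U ⟩
  prodTo h (λ i → at c i ⊓ at u i) * pow δ (n ∸ h ∸ k) * prodFromTo (n ∸ k) n (at c)
    ∎
  where
  open ≤-Reasoning
  δ = (sumFromTo h M (at u) - sumFromTo (n ∸ k) n (at c)) * inv (n ∸ h ∸ k)
  c≥0 : ∀ i → 0ℚ ≤ c i
  c≥0 i = <⇒≤ (c>0 i)
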